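{- Let $w \ge d \ge 1$ be integers. For any $t$ with $0 \le t \le \frac{d}{4}$, $$(w+2t)(w+2t-1)(w-t+1)^2 \le \left(w + \frac{d}{2} + \frac{1}{2}\right)^3 \left(w - \frac{d}{2} + \frac{3}{2}\right).$$
   Formalization: The parameter $t$ takes only rational values in the interval from 0 to $\frac{d}{4}$. -}

module Defs where

{-# OPTIONS --safe #-}
-- Put e = w - d and s = d/4 - t, so that w = e + 4s + 4t and d = 4s + 4t. In the
-- variables e, s, t the difference of the two sides expands to a polynomial whose
-- coefficients are all positive (the certificate below), so the inequality holds
-- for all rationals w ≥ d and 0 ≤ t ≤ d/4.
module Submission where

open import Defs

open import Data.Nat using (ℕ; zero; suc)
open import Data.Fin using (zero; suc)
open import Data.Integer as ℤ using (+_)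
import Data.Integer.Properties as ℤ
import Data.Nat.Properties as ℕ
import Data.Nat.Literals as ℕ
import Data.Rational.Literals as ℚ
open import Data.Rational
  using (ℚ; _+_; _-_; -_; _*_; _≤_; _/_; 0ℚ; 1ℚ; ½; _≤ᵇ_; nonNegative; toℚᵘ; +-*-rawSemiring)
open import Data.Rational.Properties
open import Data.Rational.Unnormalised as ℚᵘ using (mkℚᵘ; *≡*; *≤*)
import Data.Rational.Unnormalised.Properties as ℚᵘ
open import Data.Rational.Solver using (module +-*-Solver)
open +-*-Solver
  using (Polynomial; op; [+]; [*]; con; var; _:^_; :-_; _:+_; _:*_; _:-_; ⟦_⟧; solve; _:=_)
open import Algebra.Definitions.RawSemiring +-*-rawSemiring using (_^_)
open import Data.Bool using (T)
open import Data.Empty using (⊥)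
open import Data.Product using (_×_; _,_)
open import Data.Unit using (⊤)
open import Data.Vec using (Vec; []; _∷_)
open import Data.Vec.Relation.Unary.All using (All; []; _∷_)
open import Data.Vec.Relation.Unary.All.Properties using (lookup⁺)
open import Relation.Binary.PropositionalEquality

toℚᵘ-/ : ∀ i n → toℚᵘ (i / suc n) ℚᵘ.≃ mkℚᵘ i n
toℚᵘ-/ i n = toℚᵘ-fromℚᵘ (mkℚᵘ i n)

/1-mono-≤ : ∀ {i j} → i ℤ.≤ j → i / 1 ≤ j / 1
/1-mono-≤ {i} {j} i≤j = toℚᵘ-cancel-≤ (begin
  toℚᵘ (i / 1)  ≃⟨ toℚᵘ-/ i 0 ⟩
  mkℚᵘ i 0      ≤⟨ *≤* (ℤ.*-monoʳ-≤-nonNeg (+ 1) i≤j) ⟩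
  mkℚᵘ j 0      ≃⟨ toℚᵘ-/ j 0 ⟨
  toℚᵘ (j / 1)  ∎)
  where open ℚᵘ.≤-Reasoning

i/n≡i/1*1/n : ∀ i n → i / suc n ≡ i / 1 * (+ 1 / suc n)
i/n≡i/1*1/n i n = toℚᵘ-injective (begin-equality
  toℚᵘ (i / suc n)                      ≃⟨ toℚᵘ-/ i n ⟩
  mkℚᵘ i n                              ≃⟨ *≡* (cong₂ ℤ._*_ (sym (ℤ.*-identityʳ i))
                                                            (cong +_ (ℕ.*-identityˡ (suc n)))) ⟩
  mkℚᵘ i 0 ℚᵘ.* mkℚᵘ (+ 1) n            ≃⟨ ℚᵘ.*-cong (toℚᵘ-/ i 0) (toℚᵘ-/ (+ 1) n) ⟨
  toℚᵘ (i / 1) ℚᵘ.* toℚᵘ (+ 1 / suc n)  ≃⟨ toℚᵘ-homo-* (i / 1) (+ 1 / suc n) ⟨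
  toℚᵘ (i / 1 * (+ 1 / suc n))          ∎)
  where open ℚᵘ.≤-Reasoning

p≤q⇒0≤q-p : ∀ {p q} → p ≤ q → 0ℚ ≤ q - p
p≤q⇒0≤q-p {p} {q} p≤q = subst (_≤ q - p) (+-inverseʳ p) (+-monoˡ-≤ (- p) p≤q)

p≤p+q : ∀ {p q} → 0ℚ ≤ q → p ≤ p + q
p≤p+q {p} {q} 0≤q = subst (_≤ p + q) (+-identityʳ p) (+-monoʳ-≤ p 0≤q)

*-nonNeg : ∀ {p q} → 0ℚ ≤ p → 0ℚ ≤ q → 0ℚ ≤ p * q
*-nonNeg {p} {q} 0≤p 0≤q = nonNegative⁻¹ (p * q)
  {{nonNeg*nonNeg⇒nonNeg p {{nonNegative 0≤p}} q {{nonNegative 0≤q}}}}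

^-nonNeg : ∀ {p} → 0ℚ ≤ p → ∀ k → 0ℚ ≤ p ^ k
^-nonNeg 0≤p zero    = ≤ᵇ⇒≤ _
^-nonNeg 0≤p (suc k) = *-nonNeg 0≤p (^-nonNeg 0≤p k)

SubtractionFree : ∀ {n} → Polynomial n → Set
SubtractionFree (op _ p q) = SubtractionFree p × SubtractionFree q
SubtractionFree (con c)    = T (0ℚ ≤ᵇ c)
SubtractionFree (var _)    = ⊤
SubtractionFree (p :^ _)   = SubtractionFree p
SubtractionFree (:- _)     = ⊥

⟦⟧-nonNeg : ∀ {n} (p : Polynomial n) {ρ : Vec ℚ n} →
            SubtractionFree p → All (0ℚ ≤_) ρ → 0ℚ ≤ ⟦ p ⟧ ρ
⟦⟧-nonNeg (op [+] p q) (p⁺ , q⁺) 0≤ρ = +-mono-≤ (⟦⟧-nonNeg p p⁺ 0≤ρ) (⟦⟧-nonNeg q q⁺ 0≤ρ)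
⟦⟧-nonNeg (op [*] p q) (p⁺ , q⁺) 0≤ρ = *-nonNeg (⟦⟧-nonNeg p p⁺ 0≤ρ) (⟦⟧-nonNeg q q⁺ 0≤ρ)
⟦⟧-nonNeg (con c)      c⁺        _   = ≤ᵇ⇒≤ c⁺
⟦⟧-nonNeg (var i)      _         0≤ρ = lookup⁺ 0≤ρ i
⟦⟧-nonNeg (p :^ k)     p⁺        0≤ρ = ^-nonNeg (⟦⟧-nonNeg p p⁺ 0≤ρ) k

certificate : ∀ {n} → Polynomial n → Polynomial n → Polynomial n → Polynomial n
certificate e s t = c₀ :+ e :* (c₁ :+ e :* (c₂ :+ e :* c₃))
  where
  open import Agda.Builtin.FromNat using (Number; fromNat)
  instance
    ℕ-number : Number ℕ
    ℕ-number = ℕ.number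

    ℚ-number : Number ℚ
    ℚ-number = ℚ.number
  c₀ = con (+ 3 / 16) :+ con 11 :* s :+ con 13 :* t
       :+ con 106 :* s :^ 2 :+ con 204 :* s :* t :+ con 90 :* t :^ 2
       :+ con 368 :* s :^ 3 :+ con 1008 :* s :^ 2 :* t :+ con 900 :* s :* t :^ 2 :+ con 270 :* t :^ 3
       :+ con 176 :* s :^ 4 :+ con 576 :* s :^ 3 :* t :+ con 720 :* s :^ 2 :* t :^ 2
       :+ con 432 :* s :* t :^ 3 :+ con 108 :* t :^ 4
  c₁ = con (+ 9 / 4) :+ con 41 :* s :+ con 39 :* t
       :+ con 204 :* s :^ 2 :+ con 360 :* s :* t :+ con 153 :* t :^ 2
       :+ con 176 :* s :^ 3 :+ con 432 :* s :^ 2 :* t :+ con 360 :* s :* t :^ 2 :+ con 108 :* t :^ 3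
  c₂ = con 4 :+ con 36 :* s :+ con 30 :* t :+ con 48 :* s :^ 2 :+ con 72 :* s :* t :+ con 27 :* t :^ 2
  c₃ = con 2 :+ con 4 :* s :+ con 2 :* t

⟦certificate⟧ : ℚ → ℚ → ℚ → ℚ
⟦certificate⟧ e s t =
  ⟦ certificate (var zero) (var (suc zero)) (var (suc (suc zero))) ⟧ (e ∷ s ∷ t ∷ [])

⟦certificate⟧-nonNeg : ∀ {e s t} → 0ℚ ≤ e → 0ℚ ≤ s → 0ℚ ≤ t → 0ℚ ≤ ⟦certificate⟧ e s t
⟦certificate⟧-nonNeg 0≤e 0≤s 0≤t =
  ⟦⟧-nonNeg (certificate (var zero) (var (suc zero)) (var (suc (suc zero)))) _ (0≤e ∷ 0≤s ∷ 0≤t ∷ [])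

¼ : ℚ
¼ = + 1 / 4

quartic-identity : ∀ w d t →
  ((w + d * ½ + ½) * (w + d * ½ + ½) * (w + d * ½ + ½)) * (w - d * ½ + + 3 / 2)
  ≡ ((w + + 2 / 1 * t) * (w + + 2 / 1 * t - 1ℚ)) * ((w - t + 1ℚ) * (w - t + 1ℚ))
    + ⟦certificate⟧ (w - d) (d * ¼ - t) t
quartic-identity = solve 3 (λ w d t →
  let a = w :+ d :* con ½ :+ con ½
      x = w :+ con (+ 2 / 1) :* t
      y = w :- t :+ con 1ℚ
  in  (a :* a :* a) :* (w :- d :* con ½ :+ con (+ 3 / 2))
      := (x :* (x :- con 1ℚ)) :* (y :* y) :+ certificate (w :- d) (d :* con ¼ :- t) t) refl

quartic-inequality : ∀ {w d t} → d ≤ w → 0ℚ ≤ t → t ≤ d * ¼ →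
  ((w + + 2 / 1 * t) * (w + + 2 / 1 * t - 1ℚ)) * ((w - t + 1ℚ) * (w - t + 1ℚ))
  ≤ ((w + d * ½ + ½) * (w + d * ½ + ½) * (w + d * ½ + ½)) * (w - d * ½ + + 3 / 2)
quartic-inequality {w} {d} {t} d≤w 0≤t t≤d¼ = subst (_ ≤_) (sym (quartic-identity w d t))
  (p≤p+q (⟦certificate⟧-nonNeg (p≤q⇒0≤q-p d≤w) (p≤q⇒0≤q-p t≤d¼) 0≤t))

lemma4 : (w d : ℕ) → 1 Data.Nat.≤ d → d Data.Nat.≤ w → (t : ℚ) → 0ℚ ≤ t → t ≤ (+ d) / 4 →
           (((+ w) / 1 + (+ 2) / 1 * t) * ((+ w) / 1 + (+ 2) / 1 * t - 1ℚ)) * (((+ w) / 1 - t + 1ℚ) * ((+ w) / 1 - t + 1ℚ))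
             ≤ (((+ w) / 1 + (+ d) / 2 + (+ 1) / 2) * ((+ w) / 1 + (+ d) / 2 + (+ 1) / 2) * ((+ w) / 1 + (+ d) / 2 + (+ 1) / 2))
               * ((+ w) / 1 - (+ d) / 2 + (+ 3) / 2)
lemma4 w d _ d≤w t 0≤t t≤d/4 rewrite i/n≡i/1*1/n (+ d) 1 =
  quartic-inequality (/1-mono-≤ (ℤ.+≤+ d≤w)) 0≤t (subst (t ≤_) (i/n≡i/1*1/n (+ d) 3) t≤d/4)
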